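{- Let $W_{af}$ be a Coxeter group with set of simple reflections $\tilde S$, let $\Omega$ be a finite abelian group acting on $W_{af}$ by automorphisms permuting $\tilde S$, and put $\tilde W = W_{af}\rtimes \Omega$ with length function $\ell(w\rho)=\ell(\rho w)=\ell(w)$ for $w\in W_{af}$, $\rho\in\Omega$ (where $\ell$ on $W_{af}$ is the Coxeter length with respect to $\tilde S$). Let $W_1=\langle S_1\rangle$ and $W_2=\langle S_2\rangle$ with $S_1,S_2\subseteq \tilde S$ be special subgroups of $W_{af}$, put $W_{1,2}=W_1\cap W_2$, let $\Omega_1\le\Omega$ be a subgroup fixing $S_1$ and set $W_1'=W_1\Omega_1$. Let $\sigma\in W_1'$ be of minimal length in its double coset $W_{1,2}\sigma W_{1,2}$. Then for all $w_2\in W_2$, $$\ell(\sigma w_2)=\ell(w_2\sigma)=\ell(w_2)+\ell(\sigma).$$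
   Context: A special (standard parabolic) subgroup of $W_{af}$ is a subgroup generated by a subset of $\tilde S$; it equals the subgroup generated by its intersection with $\tilde S$. In the paper this setting arises as the extended affine Weyl group $\tilde W$ of a split semisimple group over a $p$-adic field, with affine Weyl group $W_{af}$ and $\Omega\cong X_*(T)/\langle \Phi^\vee\rangle$. -}

module Defs where

open import Level using (0ℓ)
open import Data.Nat using (ℕ; zero; suc; _≤_)
open import Data.Maybe using (Maybe; just; nothing)
open import Data.List using (List; []; _∷_; _++_; length; map)
open import Data.List.Relation.Unary.All using (All)
open import Data.Product using (Σ; _×_; _,_)
open import Data.Sum using (_⊎_)
open import Data.Fin using (Fin)
open import Relation.Binary.PropositionalEquality using (_≡_)
open import Relation.Nullary using (¬_)
open import Algebra.Bundles using (AbelianGroup)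

-- A Coxeter matrix on a set S of generators; nothing = ∞.
record CoxeterMatrix : Set₁ where
  field
    S      : Set
    m      : S → S → Maybe ℕ
    m-diag : ∀ s → m s s ≡ just 1
    m-sym  : ∀ s t → m s t ≡ m t s
    m-off  : ∀ s t → ¬ (s ≡ t) → (m s t ≡ nothing) ⊎ (Σ ℕ λ k → m s t ≡ just k × 2 ≤ k)

module _ (M : CoxeterMatrix) where
  open CoxeterMatrix M

  -- words in the generators; the Coxeter group W is the set of words modulo _~_
  Word : Set
  Word = List S

  alt : S → S → ℕ → Word
  alt s t zero    = []
  alt s t (suc k) = s ∷ t ∷ alt s t k

  data Relator : Word → Set where
    rel : ∀ s t k → m s t ≡ just k → Relator (alt s t k)

  -- equality in W = <S | (st)^m(s,t) = 1>; since all generators are involutions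
  -- the monoid presentation below presents the group.
  infix 4 _~_
  data _~_ : Word → Word → Set where
    ~refl  : ∀ {u} → u ~ u
    ~sym   : ∀ {u v} → u ~ v → v ~ u
    ~trans : ∀ {u v w} → u ~ v → v ~ w → u ~ w
    ~del   : ∀ u r v → Relator r → (u ++ r ++ v) ~ (u ++ v)

  IsLength : Word → ℕ → Set
  IsLength w n = (Σ Word λ v → (v ~ w) × (length v ≡ n)) × (∀ v → v ~ w → n ≤ length v)

  InSpecial : (S → Set) → Word → Set
  InSpecial P w = Σ Word λ v → (v ~ w) × All P v

  record FinAbActing : Set₁ where
    field
      Ω      : AbelianGroup 0ℓ 0ℓ
    open AbelianGroup Ω public
    field
      finite  : Σ ℕ λ n → Σ (Fin n → Carrier) λ f → ∀ x → Σ (Fin n) λ i → f i ≈ x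
      act     : Carrier → S → S
      act-≈   : ∀ {x y} → x ≈ y → ∀ s → act x s ≡ act y s
      act-ε   : ∀ s → act ε s ≡ s
      act-∙   : ∀ x y s → act (x ∙ y) s ≡ act x (act y s)
      act-hom : ∀ x {u v} → u ~ v → map (act x) u ~ map (act x) v

    -- elements w ρ of W̃ = W ⋊ Ω, represented as (word for w , ρ)
    W̃ : Set
    W̃ = Word × Carrier

    -- (w ρ)(w' ρ') = (w ρ(w')) (ρ ρ')
    _·_ : W̃ → W̃ → W̃
    (w , ρ) · (w' , ρ') = (w ++ map (act ρ) w') , (ρ ∙ ρ')

    ι : Word → W̃
    ι w = w , ε

    IsLength̃ : W̃ → ℕ → Set
    IsLength̃ (w , ρ) n = IsLength w n

    record Subgroup : Set₁ where
      field
        mem   : Carrier → Set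
        resp  : ∀ {x y} → x ≈ y → mem x → mem y
        has-ε : mem ε
        has-∙ : ∀ {x y} → mem x → mem y → mem (x ∙ y)
        has-⁻¹ : ∀ {x} → mem x → mem (x ⁻¹)

-- Tits' argument.  For a word w and t ∈ W let η(w, t) be the parity of the number of
-- occurrences of t among the left inversions s₁, s₁s₂s₁, … of w.  It only depends on
-- the element of W, and it is odd exactly when ℓ(t w) < ℓ(w); in particular
-- ℓ(s w) = ℓ(w) ∓ 1 according to η(w, s).  If σ = u ρ is minimal in W₁₂ σ W₁₂, no
-- reflection t ∈ W₂ has η(u, t) odd: such t lies in W₁ since u does, so t ∈ W₁₂ and
-- ℓ(t σ) < ℓ(σ).  Then η(q u, s) = η(q, s) for q ∈ W₂ and s ∈ S₂, so left
-- multiplication by s changes ℓ(q u) and ℓ(q) alike, and induction on q gives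
-- ℓ(w₂ σ) = ℓ(w₂) + ℓ(σ).  Inverting σ gives the other product.
module Submission where

open import Defs
open import Level using (0ℓ)
open import Data.Nat using (ℕ; zero; suc; _+_; _≤_; _<_; z≤n; s≤s)
open import Data.Nat.Properties
  using (≤-refl; ≤-antisym; ≤-pred; <-irrefl; <-≤-trans; ≤-<-trans; ≮⇒≥; suc-injective; +-suc; +-identityʳ; _<?_)
  renaming (_≟_ to _≟ℕ_)
open import Data.List using (List; []; _∷_; [_]; _++_; length; map; reverse)
open import Data.List.Properties
  using (++-assoc; ++-identityʳ; length-map; length-reverse; reverse-++; reverse-involutive; unfold-reverse; map-cong; map-id; map-∘; map-++)
open import Data.List.Relation.Unary.All as All using (All; []; _∷_)
open import Data.List.Relation.Unary.Any using (Any; here; there)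
import Data.List.Relation.Unary.All.Properties as All
import Relation.Binary.Reasoning.Setoid
open import Data.Product using (∃; _×_; _,_)
open import Data.Empty using (⊥)
open import Effect.Monad using (RawMonad)
open import Function.Bundles using (_⇔_; Equivalence)
open import Relation.Binary.Bundles using (Setoid)
open import Relation.Binary.PropositionalEquality
  using (_≡_; refl; sym; trans; cong; cong₂; subst; module ≡-Reasoning)
open import Relation.Nullary using (¬_; Dec; yes; no; contradiction)
open import Relation.Nullary.Decidable using (decidable-stable; ¬¬-excluded-middle)
open import Relation.Nullary.Negation using (¬¬-Monad)

All-reverse : ∀ {A : Set} {P : A → Set} {xs} → All P xs → All P (reverse xs)
All-reverse              []         = []
All-reverse {xs = x ∷ xs} (Px ∷ Pxs) =
  subst (All _) (sym (unfold-reverse x xs)) (All.∷ʳ⁺ (All-reverse Pxs) Px)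

module CoxeterGroup (M : CoxeterMatrix) where
  open CoxeterMatrix M
  open import Data.Parity.Base using (Parity; 0ℙ; 1ℙ) renaming (_+_ to _⊕_)
  open import Data.Parity.Properties using (p+p≡0ℙ)
    renaming (_≟_ to _≟ℙ_; +-assoc to ⊕-assoc; +-identityʳ to ⊕-identityʳ)
  open RawMonad (¬¬-Monad {0ℓ})

  infix 4 _≈_
  _≈_ : Word M → Word M → Set
  _≈_ = _~_ M

  ≈-setoid : Setoid 0ℓ 0ℓ
  ≈-setoid = record
    { Carrier = Word M
    ; _≈_ = _≈_
    ; isEquivalence = record { refl = ~refl ; sym = ~sym ; trans = ~trans } }

  module ≈-Reasoning = Relation.Binary.Reasoning.Setoid ≈-setoid

  ≡⇒≈ : ∀ {v w} → v ≡ w → v ≈ w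
  ≡⇒≈ refl = ~refl

  ++-infix-cong : ∀ x y {v w} → v ≈ w → x ++ v ++ y ≈ x ++ w ++ y
  ++-infix-cong x y ~refl         = ~refl
  ++-infix-cong x y (~sym p)      = ~sym (++-infix-cong x y p)
  ++-infix-cong x y (~trans p q)  = ~trans (++-infix-cong x y p) (++-infix-cong x y q)
  ++-infix-cong x y (~del u r v rel-r) = begin
    x ++ (u ++ r ++ v) ++ y   ≡⟨ cong (x ++_) (trans (++-assoc u _ y) (cong (u ++_) (++-assoc r v y))) ⟩
    x ++ u ++ r ++ v ++ y     ≡⟨ ++-assoc x u _ ⟨
    (x ++ u) ++ r ++ v ++ y   ≈⟨ ~del (x ++ u) r (v ++ y) rel-r ⟩
    (x ++ u) ++ v ++ y        ≡⟨ ++-assoc x u _ ⟩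
    x ++ u ++ v ++ y          ≡⟨ cong (x ++_) (++-assoc u v y) ⟨
    x ++ (u ++ v) ++ y        ∎
    where open ≈-Reasoning

  ++-congˡ : ∀ x {v w} → v ≈ w → x ++ v ≈ x ++ w
  ++-congˡ x {v} {w} p = begin
    x ++ v        ≡⟨ cong (x ++_) (++-identityʳ v) ⟨
    x ++ v ++ []  ≈⟨ ++-infix-cong x [] p ⟩
    x ++ w ++ []  ≡⟨ cong (x ++_) (++-identityʳ w) ⟩
    x ++ w        ∎
    where open ≈-Reasoning

  ++-congʳ : ∀ y {v w} → v ≈ w → v ++ y ≈ w ++ y
  ++-congʳ y = ++-infix-cong [] y

  ++-cong : ∀ {v v′ w w′} → v ≈ v′ → w ≈ w′ → v ++ w ≈ v′ ++ w′
  ++-cong {v′ = v′} {w} p q = ~trans (++-congʳ w p) (++-congˡ v′ q)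

  relator≈[] : ∀ {r} → Relator M r → r ≈ []
  relator≈[] {r} rel-r = ~trans (≡⇒≈ (sym (++-identityʳ r))) (~del [] r [] rel-r)

  delete-ss : ∀ x s y → x ++ s ∷ s ∷ y ≈ x ++ y
  delete-ss x s y = ~del x (s ∷ s ∷ []) y (rel s s 1 (m-diag s))

  reverse-alt : ∀ s t k → reverse (alt M s t k) ≡ alt M t s k
  reverse-alt s t zero    = refl
  reverse-alt s t (suc k) =
    trans (reverse-++ (s ∷ t ∷ []) (alt M s t k))
          (trans (cong (_++ t ∷ s ∷ []) (reverse-alt s t k)) (alt-snoc k))
    where
    alt-snoc : ∀ k → alt M t s k ++ t ∷ s ∷ [] ≡ t ∷ s ∷ alt M t s k
    alt-snoc zero    = refl
    alt-snoc (suc k) = cong (λ w → t ∷ s ∷ w) (alt-snoc k)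

  reverse-relator : ∀ {r} → Relator M r → Relator M (reverse r)
  reverse-relator (rel s t k m≡k) =
    subst (Relator M) (sym (reverse-alt s t k)) (rel t s k (trans (m-sym t s) m≡k))

  reverse-cong : ∀ {v w} → v ≈ w → reverse v ≈ reverse w
  reverse-cong ~refl        = ~refl
  reverse-cong (~sym p)     = ~sym (reverse-cong p)
  reverse-cong (~trans p q) = ~trans (reverse-cong p) (reverse-cong q)
  reverse-cong (~del u r v rel-r) = begin
    reverse (u ++ r ++ v)                  ≡⟨ reverse-++ u (r ++ v) ⟩
    reverse (r ++ v) ++ reverse u          ≡⟨ cong (_++ reverse u) (reverse-++ r v) ⟩
    (reverse v ++ reverse r) ++ reverse u  ≡⟨ ++-assoc (reverse v) (reverse r) (reverse u) ⟩
    reverse v ++ reverse r ++ reverse u    ≈⟨ ~del (reverse v) (reverse r) (reverse u) (reverse-relator rel-r) ⟩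
    reverse v ++ reverse u                 ≡⟨ reverse-++ u v ⟨
    reverse (u ++ v)                       ∎
    where open ≈-Reasoning

  InSpecial-[] : ∀ {P} → InSpecial M P []
  InSpecial-[] = [] , ~refl , []

  InSpecial-reverse : ∀ {P w} → InSpecial M P w → InSpecial M P (reverse w)
  InSpecial-reverse (v , v≈w , Pv) = reverse v , reverse-cong v≈w , All-reverse Pv

  reverse-inverseˡ : ∀ x → reverse x ++ x ≈ []
  reverse-inverseˡ []      = ~refl
  reverse-inverseˡ (s ∷ x) = begin
    reverse (s ∷ x) ++ s ∷ x       ≡⟨ cong (_++ s ∷ x) (unfold-reverse s x) ⟩
    (reverse x ++ [ s ]) ++ s ∷ x  ≡⟨ ++-assoc (reverse x) [ s ] (s ∷ x) ⟩
    reverse x ++ s ∷ s ∷ x         ≈⟨ delete-ss (reverse x) s x ⟩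
    reverse x ++ x                 ≈⟨ reverse-inverseˡ x ⟩
    []                             ∎
    where open ≈-Reasoning

  conjBy : Word M → Word M → Word M
  conjBy x w = x ++ w ++ reverse x

  conjBy-cong : ∀ x {v w} → v ≈ w → conjBy x v ≈ conjBy x w
  conjBy-cong x = ++-infix-cong x (reverse x)

  conjBy-trivial : ∀ {x} → x ≈ [] → ∀ w → conjBy x w ≈ w
  conjBy-trivial {x} x≈[] w = begin
    x ++ w ++ reverse x  ≈⟨ ++-cong x≈[] (++-congˡ w (reverse-cong x≈[])) ⟩
    w ++ []              ≡⟨ ++-identityʳ w ⟩
    w                    ∎
    where open ≈-Reasoning

  conjBy-reverse : ∀ x w → conjBy (reverse x) (conjBy x w) ≈ w
  conjBy-reverse x w = begin
    x⁻ ++ (x ++ w ++ x⁻) ++ reverse x⁻  ≡⟨ cong (λ y → x⁻ ++ (x ++ w ++ x⁻) ++ y) (reverse-involutive x) ⟩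
    x⁻ ++ (x ++ w ++ x⁻) ++ x           ≡⟨ cong (x⁻ ++_) (++-assoc x (w ++ x⁻) x) ⟩
    x⁻ ++ x ++ (w ++ x⁻) ++ x           ≡⟨ ++-assoc x⁻ x _ ⟨
    (x⁻ ++ x) ++ (w ++ x⁻) ++ x         ≡⟨ cong ((x⁻ ++ x) ++_) (++-assoc w x⁻ x) ⟩
    (x⁻ ++ x) ++ w ++ x⁻ ++ x           ≈⟨ ++-cong (reverse-inverseˡ x) (++-congˡ w (reverse-inverseˡ x)) ⟩
    w ++ []                             ≡⟨ ++-identityʳ w ⟩
    w                                   ∎
    where
    open ≈-Reasoning
    x⁻ = reverse x

  conjBy-reverse′ : ∀ x w → conjBy x (conjBy (reverse x) w) ≈ w
  conjBy-reverse′ x w =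
    subst (λ y → conjBy y (conjBy (reverse x) w) ≈ w) (reverse-involutive x) (conjBy-reverse (reverse x) w)

  conjBy-∷ : ∀ s x w → conjBy [ s ] (conjBy x w) ≡ conjBy (s ∷ x) w
  conjBy-∷ s x w = cong (s ∷_) (begin
    (x ++ w ++ reverse x) ++ [ s ]   ≡⟨ ++-assoc x _ [ s ] ⟩
    x ++ (w ++ reverse x) ++ [ s ]   ≡⟨ cong (x ++_) (++-assoc w (reverse x) [ s ]) ⟩
    x ++ w ++ reverse x ++ [ s ]     ≡⟨ cong (λ y → x ++ w ++ y) (unfold-reverse s x) ⟨
    x ++ w ++ reverse (s ∷ x)        ∎)
    where open ≡-Reasoning

  -- Equality in W is not decidable, so the parity of the number of entries of a
  -- list that are equal to a given element is a relation rather than a function.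
  data Count : List (Word M) → Word M → Parity → Set where
    []   : ∀ {t} → Count [] t 0ℙ
    hit  : ∀ {r L t p} → r ≈ t → Count L t p → Count (r ∷ L) t (1ℙ ⊕ p)
    miss : ∀ {r L t p} → ¬ r ≈ t → Count L t p → Count (r ∷ L) t p

  count-unique : ∀ {L t p q} → Count L t p → Count L t q → p ≡ q
  count-unique []           []           = refl
  count-unique (hit _ c)    (hit _ d)    = cong (1ℙ ⊕_) (count-unique c d)
  count-unique (hit r≈t _)  (miss r≉t _) = contradiction r≈t r≉t
  count-unique (miss r≉t _) (hit r≈t _)  = contradiction r≈t r≉t
  count-unique (miss _ c)   (miss _ d)   = count-unique c d

  count-exists : ∀ L t → ¬ ¬ ∃ (Count L t)
  count-exists []      t = pure (0ℙ , [])
  count-exists (r ∷ L) t = do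
    (_ , c) ← count-exists L t
    r≈t? ← ¬¬-excluded-middle
    pure (extend r≈t? c)
    where
    extend : ∀ {p} → Dec (r ≈ t) → Count L t p → ∃ (Count (r ∷ L) t)
    extend (yes r≈t) c = _ , hit r≈t c
    extend (no r≉t)  c = _ , miss r≉t c

  count-resp : ∀ {L t t′ p} → t ≈ t′ → Count L t p → Count L t′ p
  count-resp t≈t′ []           = []
  count-resp t≈t′ (hit r≈t c)  = hit (~trans r≈t t≈t′) (count-resp t≈t′ c)
  count-resp t≈t′ (miss r≉t c) = miss (λ r≈t′ → r≉t (~trans r≈t′ (~sym t≈t′))) (count-resp t≈t′ c)

  count-++ : ∀ {L L′ t p q} → Count L t p → Count L′ t q → Count (L ++ L′) t (p ⊕ q)
  count-++ []                                d = d
  count-++ {q = q} (hit {p = p} r≈t c) d = subst (Count _ _) (sym (⊕-assoc 1ℙ p q)) (hit r≈t (count-++ c d))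
  count-++ (miss r≉t c)                      d = miss r≉t (count-++ c d)

  count-++⁻ : ∀ L {L′ t p} → Count (L ++ L′) t p →
              ∃ λ p₁ → ∃ λ p₂ → Count L t p₁ × Count L′ t p₂ × p ≡ p₁ ⊕ p₂
  count-++⁻ []      c = 0ℙ , _ , [] , c , refl
  count-++⁻ (r ∷ L) (hit r≈t c) with count-++⁻ L c
  ... | p₁ , p₂ , c₁ , c₂ , refl = 1ℙ ⊕ p₁ , p₂ , hit r≈t c₁ , c₂ , sym (⊕-assoc 1ℙ p₁ p₂)
  count-++⁻ (r ∷ L) (miss r≉t c) with count-++⁻ L c
  ... | p₁ , p₂ , c₁ , c₂ , e = p₁ , p₂ , miss r≉t c₁ , c₂ , e

  module _ {f g : Word M → Word M}
           (f-cong : ∀ {v w} → v ≈ w → f v ≈ f w) (g-cong : ∀ {v w} → v ≈ w → g v ≈ g w)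
           (f∘g≈id : ∀ w → f (g w) ≈ w) (g∘f≈id : ∀ w → g (f w) ≈ w) where

    count-map : ∀ {L t p} → Count L (g t) p → Count (map f L) t p
    count-map []                    = []
    count-map {t = t} (hit r≈gt c)  = hit (~trans (f-cong r≈gt) (f∘g≈id t)) (count-map c)
    count-map {r ∷ _} (miss r≉gt c) =
      miss (λ fr≈t → r≉gt (~trans (~sym (g∘f≈id r)) (g-cong fr≈t))) (count-map c)

    count-map⁻ : ∀ {L t p} → Count (map f L) t p → Count L (g t) p
    count-map⁻ {[]}    []                = []
    count-map⁻ {r ∷ _} (hit fr≈t c)      = hit (~trans (~sym (g∘f≈id r)) (g-cong fr≈t)) (count-map⁻ c)
    count-map⁻ {r ∷ _} {t} (miss fr≉t c) =
      miss (λ r≈gt → fr≉t (~trans (f-cong r≈gt) (f∘g≈id t))) (count-map⁻ c)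

  count-conjBy : ∀ x {L t p} → Count L (conjBy (reverse x) t) p → Count (map (conjBy x) L) t p
  count-conjBy x = count-map (conjBy-cong x) (conjBy-cong (reverse x)) (conjBy-reverse′ x) (conjBy-reverse x)

  count-conjBy⁻ : ∀ x {L t p} → Count (map (conjBy x) L) t p → Count L (conjBy (reverse x) t) p
  count-conjBy⁻ x = count-map⁻ (conjBy-cong x) (conjBy-cong (reverse x)) (conjBy-reverse′ x) (conjBy-reverse x)

  -- reflections (s₁ ⋯ sₙ) = s₁, s₁s₂s₁, …, s₁⋯sₙ⋯s₁; the parity of the count of t in it is η(w, t)
  reflections : Word M → List (Word M)
  reflections []      = []
  reflections (s ∷ w) = [ s ] ∷ map (conjBy [ s ]) (reflections w)

  reflections-++ : ∀ x y → reflections (x ++ y) ≡ reflections x ++ map (conjBy x) (reflections y)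
  reflections-++ []      y = sym (trans (map-cong ++-identityʳ (reflections y)) (map-id (reflections y)))
  reflections-++ (s ∷ x) y = cong ([ s ] ∷_) (begin
    map (conjBy [ s ]) (reflections (x ++ y))
      ≡⟨ cong (map (conjBy [ s ])) (reflections-++ x y) ⟩
    map (conjBy [ s ]) (Rx ++ map (conjBy x) Ry)
      ≡⟨ map-++ (conjBy [ s ]) Rx _ ⟩
    map (conjBy [ s ]) Rx ++ map (conjBy [ s ]) (map (conjBy x) Ry)
      ≡⟨ cong (map (conjBy [ s ]) Rx ++_) (trans (sym (map-∘ Ry)) (map-cong (conjBy-∷ s x) Ry)) ⟩
    map (conjBy [ s ]) Rx ++ map (conjBy (s ∷ x)) Ry
      ∎)
    where
    open ≡-Reasoning
    Rx = reflections x
    Ry = reflections y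

  count-reflections-++ : ∀ x y {t p q} → Count (reflections x) t p →
    Count (reflections y) (conjBy (reverse x) t) q → Count (reflections (x ++ y)) t (p ⊕ q)
  count-reflections-++ x y c d =
    subst (λ L → Count L _ _) (sym (reflections-++ x y)) (count-++ c (count-conjBy x d))

  count-reflections-++⁻ : ∀ x {y t p} → Count (reflections (x ++ y)) t p →
    ∃ λ p₁ → ∃ λ p₂ → Count (reflections x) t p₁ × Count (reflections y) (conjBy (reverse x) t) p₂ × p ≡ p₁ ⊕ p₂
  count-reflections-++⁻ x {y} c
    with count-++⁻ (reflections x) (subst (λ L → Count L _ _) (reflections-++ x y) c)
  ... | p₁ , p₂ , c₁ , c₂ , e = p₁ , p₂ , c₁ , count-conjBy⁻ x c₂ , e

  module Dihedral (s t : S) where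

    dihedral : ℕ → Word M
    dihedral i = alt M s t i ++ [ s ]

    dihedrals : ℕ → ℕ → List (Word M)
    dihedrals a zero    = []
    dihedrals a (suc n) = dihedral a ∷ dihedrals (suc a) n

    conj-dihedral : ∀ a → conjBy [ s ] (conjBy [ t ] (dihedral a)) ≡ dihedral (2 + a)
    conj-dihedral a = cong (λ w → s ∷ t ∷ w) (snoc a)
      where
      snoc : ∀ a → (dihedral a ++ [ t ]) ++ [ s ] ≡ s ∷ t ∷ dihedral a
      snoc zero    = refl
      snoc (suc a) = cong (λ w → s ∷ t ∷ w) (snoc a)

    map-conj-dihedrals : ∀ a n → map (conjBy [ s ]) (map (conjBy [ t ]) (dihedrals a n)) ≡ dihedrals (2 + a) n
    map-conj-dihedrals a zero    = refl
    map-conj-dihedrals a (suc n) = cong₂ _∷_ (conj-dihedral a) (map-conj-dihedrals (suc a) n)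

    reflections-alt : ∀ k → reflections (alt M s t k) ≡ dihedrals 0 (k + k)
    reflections-alt zero    = refl
    reflections-alt (suc k) rewrite +-suc k k | reflections-alt k | map-conj-dihedrals 0 (k + k) = refl

    dihedrals-++ : ∀ a m n → dihedrals a (m + n) ≡ dihedrals a m ++ dihedrals (a + m) n
    dihedrals-++ a zero    n rewrite +-identityʳ a = refl
    dihedrals-++ a (suc m) n rewrite dihedrals-++ (suc a) m n | +-suc a m = refl

    alt-+ : ∀ k a → alt M s t (k + a) ≡ alt M s t k ++ alt M s t a
    alt-+ zero    a = refl
    alt-+ (suc k) a = cong (λ w → s ∷ t ∷ w) (alt-+ k a)

    module _ {k} (alt≈[] : alt M s t k ≈ []) where

      dihedral-periodic : ∀ a → dihedral (a + k) ≈ dihedral a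
      dihedral-periodic a = ~trans
        (≡⇒≈ (trans (cong (_++ [ s ]) (alt-+ a k)) (++-assoc (alt M s t a) (alt M s t k) [ s ])))
        (++-infix-cong (alt M s t a) [ s ] alt≈[])

      count-dihedrals-periodic : ∀ a n {x p} → Count (dihedrals (a + k) n) x p → Count (dihedrals a n) x p
      count-dihedrals-periodic a zero    []           = []
      count-dihedrals-periodic a (suc n) (hit d≈x c)  =
        hit (~trans (~sym (dihedral-periodic a)) d≈x) (count-dihedrals-periodic (suc a) n c)
      count-dihedrals-periodic a (suc n) (miss d≉x c) =
        miss (λ d≈x → d≉x (~trans (dihedral-periodic a) d≈x)) (count-dihedrals-periodic (suc a) n c)

      -- as (st)ᵏ = 1, the 2k reflections of (st)ᵏ are the first k dihedral ones, twice
      count-reflections-alt : ∀ {x p} → Count (reflections (alt M s t k)) x p → p ≡ 0ℙ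
      count-reflections-alt c
        with count-++⁻ (dihedrals 0 k) (subst (λ L → Count L _ _) (trans (reflections-alt k) (dihedrals-++ 0 k k)) c)
      ... | p₁ , p₂ , c₁ , c₂ , refl =
        trans (cong (p₁ ⊕_) (count-unique c₂′ c₁)) (p+p≡0ℙ p₁)
        where c₂′ = count-dihedrals-periodic 0 k c₂

  count-reflections-relator : ∀ {r t p} → Relator M r → Count (reflections r) t p → p ≡ 0ℙ
  count-reflections-relator rel-r@(rel s t k _) = Dihedral.count-reflections-alt s t (relator≈[] rel-r)

  count-reflections-cong : ∀ {v w t p q} → v ≈ w → Count (reflections v) t p → Count (reflections w) t q → p ≡ q
  count-reflections-cong ~refl      c d = count-unique c d
  count-reflections-cong (~sym w≈v) c d = sym (count-reflections-cong w≈v d c)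
  count-reflections-cong {t = t} {p} {q} (~trans {v = m} v≈m m≈w) c d = decidable-stable (p ≟ℙ q) do
    (_ , cm) ← count-exists (reflections m) t
    pure (trans (count-reflections-cong v≈m c cm) (count-reflections-cong m≈w cm d))
  count-reflections-cong (~del u r v rel-r) c d
    with count-reflections-++⁻ u c | count-reflections-++⁻ u d
  ... | _ , _ , cu , crv , refl | _ , _ , du , dv , refl
    with count-reflections-++⁻ r crv
  ... | _ , _ , cr , cv , refl =
    cong₂ _⊕_ (count-unique cu du)
      (cong₂ _⊕_ (count-reflections-relator rel-r cr) (count-unique cv′ dv))
    where cv′ = count-resp (conjBy-trivial (reverse-cong (relator≈[] rel-r)) _) cv

  count-reflections-resp : ∀ {v w t p} → v ≈ w → Count (reflections v) t p → ¬ ¬ Count (reflections w) t p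
  count-reflections-resp {w = w} {t} v≈w c = do
    (_ , d) ← count-exists (reflections w) t
    pure (subst (Count _ _) (sym (count-reflections-cong v≈w c d)) d)

  count-odd⇒Any : ∀ {L t p} → Count L t p → p ≡ 1ℙ → Any (_≈ t) L
  count-odd⇒Any (hit r≈t _) _   = here r≈t
  count-odd⇒Any (miss _ c)  odd = there (count-odd⇒Any c odd)

  reflections-special : ∀ {P : S → Set} {w} → All P w → All (All P) (reflections w)
  reflections-special []        = []
  reflections-special (Ps ∷ Pw) =
    (Ps ∷ []) ∷ All.map⁺ (All.map (λ Pr → Ps ∷ All.++⁺ Pr (Ps ∷ [])) (reflections-special Pw))

  Len : Word M → ℕ → Set
  Len = IsLength M

  length-[] : Len [] 0
  length-[] = ([] , ~refl , refl) , λ _ _ → z≤n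

  length-unique : ∀ {w m n} → Len w m → Len w n → m ≡ n
  length-unique ((v , v≈w , refl) , v-min) ((v′ , v′≈w , refl) , v′-min) =
    ≤-antisym (v-min v′ v′≈w) (v′-min v v≈w)

  IsLength-resp : ∀ {v w n} → v ≈ w → Len v n → Len w n
  IsLength-resp v≈w ((x , x≈v , lx) , x-min) = (x , ~trans x≈v v≈w , lx) , λ y y≈w → x-min y (~trans y≈w (~sym v≈w))

  IsLength-reverse : ∀ {w n} → Len w n → Len (reverse w) n
  IsLength-reverse {w} ((v , v≈w , lv) , v-min) =
    (reverse v , reverse-cong v≈w , trans (length-reverse v) lv) ,
    λ y y≈w⁻ → subst (_ ≤_) (length-reverse y)
      (v-min (reverse y) (~trans (reverse-cong y≈w⁻) (≡⇒≈ (reverse-involutive w))))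

  ¬¬-minimum : ∀ {P : ℕ → Set} m → P m → ¬ ¬ ∃ λ n → P n × (∀ k → P k → n ≤ k)
  ¬¬-minimum {P} m Pm no-minimum = below (suc m) Pm ≤-refl
    where
    below : ∀ N {n} → P n → n < N → ⊥
    below (suc N) {n} Pn n<1+N with n <? N
    ... | yes n<N = below N Pn n<N
    ... | no  n≮N = no-minimum (n , Pn , λ k Pk → ≮⇒≥ (λ k<n → below N Pk (<-≤-trans k<n (≤-pred n<1+N))))

  length-exists : ∀ w → ¬ ¬ ∃ (Len w)
  length-exists w = do
    (n , reduced , reduced-min) ← ¬¬-minimum (length w) (w , ~refl , refl)
    pure (n , reduced , λ v v≈w → reduced-min (length v) (v , v≈w , refl))

  length-∷-≤ : ∀ {s w n m} → Len w n → Len (s ∷ w) m → m ≤ suc n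
  length-∷-≤ {s} ((v , v≈w , refl) , _) (_ , reduced-min) = reduced-min (s ∷ v) (++-congˡ [ s ] v≈w)

  length-∷-≥ : ∀ {s w n m} → Len w n → Len (s ∷ w) m → n ≤ suc m
  length-∷-≥ {s} {w} ℓw ℓsw = length-∷-≤ ℓsw (IsLength-resp (~sym (delete-ss [] s w)) ℓw)

  deletion : ∀ w {t p} → Count (reflections w) t p → p ≡ 1ℙ →
             ∃ λ w′ → t ++ w ≈ w′ × suc (length w′) ≡ length w
  deletion []      []           ()
  deletion (s ∷ w) {t} (hit s≈t _) _ = w , ~trans (++-congʳ (s ∷ w) (~sym s≈t)) (delete-ss [] s w) , refl
  deletion (s ∷ w) {t} (miss _ c) odd with deletion w (count-conjBy⁻ [ s ] c) odd
  ... | w′ , sts·w≈w′ , length-w′ = s ∷ w′ , t·sw≈sw′ , cong suc length-w′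
    where
    open ≈-Reasoning
    t·sw≈sw′ : t ++ s ∷ w ≈ s ∷ w′
    t·sw≈sw′ = begin
      t ++ s ∷ w                  ≈⟨ delete-ss [] s (t ++ s ∷ w) ⟨
      s ∷ s ∷ t ++ s ∷ w          ≡⟨ cong (λ y → s ∷ s ∷ y) (++-assoc t [ s ] w) ⟨
      s ∷ (s ∷ t ++ [ s ]) ++ w   ≈⟨ ++-congˡ [ s ] sts·w≈w′ ⟩
      s ∷ w′                      ∎

  length-reflection-< : ∀ {w t n m} → Len w n → Count (reflections w) t 1ℙ → Len (t ++ w) m → m < n
  length-reflection-< {w} {t} {n} {m} ((v , v≈w , refl) , _) c (_ , tw-min) =
    decidable-stable (m <? n) do
      cv ← count-reflections-resp (~sym v≈w) c
      let (v′ , tv≈v′ , length-v′) = deletion v cv refl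
      pure (subst (suc m ≤_) length-v′ (s≤s (tw-min v′ (~trans (~sym tv≈v′) (++-congˡ t v≈w)))))

  count-reflections-∷-self : ∀ {s w p} → Count (reflections w) [ s ] p → Count (reflections (s ∷ w)) [ s ] (1ℙ ⊕ p)
  count-reflections-∷-self {s} c = hit ~refl (count-conjBy [ s ] (count-resp (~sym (delete-ss [] s [ s ])) c))

  LengthStep : Parity → ℕ → ℕ → Set
  LengthStep 0ℙ n m = m ≡ suc n
  LengthStep 1ℙ n m = suc m ≡ n

  length-∷ : ∀ {s w n m p} → Len w n → Len (s ∷ w) m → Count (reflections w) [ s ] p → LengthStep p n m
  length-∷ {s} {w} {p = 0ℙ} ℓw ℓsw c =
    ≤-antisym (length-∷-≤ ℓw ℓsw)
      (length-reflection-< ℓsw (count-reflections-∷-self c) (IsLength-resp (~sym (delete-ss [] s w)) ℓw))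
  length-∷ {p = 1ℙ} ℓw ℓsw c = ≤-antisym (length-reflection-< ℓw c ℓsw) (length-∷-≥ ℓw ℓsw)

  LengthStep-+ : ∀ p {d e e′ f f′} → LengthStep p e′ e → LengthStep p f′ f → f′ ≡ e′ + d → f ≡ e + d
  LengthStep-+ 0ℙ refl refl refl = refl
  LengthStep-+ 1ℙ refl refl f′≡e′+d = suc-injective f′≡e′+d

  NoInversionIn : (S → Set) → Word M → Set
  NoInversionIn Q u = ∀ t → All Q t → ¬ Count (reflections u) t 1ℙ

  module _ {Q u d} (ℓu : Len u d) (u-noInv : NoInversionIn Q u) where

    count-reflections-even : ∀ {t p} → All Q t → Count (reflections u) t p → p ≡ 0ℙ
    count-reflections-even {p = 0ℙ} _  _ = refl
    count-reflections-even {p = 1ℙ} Qt c = contradiction c (u-noInv _ Qt)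

    length-++-additive : ∀ q → All Q q → ∀ {e f} → Len q e → Len (q ++ u) f → f ≡ e + d
    length-++-additive []      []        ℓ[] ℓu′ =
      trans (length-unique ℓu′ ℓu) (cong (_+ d) (length-unique length-[] ℓ[]))
    length-++-additive (s ∷ q) (Qs ∷ Qq) {e} {f} ℓsq ℓsqu = decidable-stable (f ≟ℕ e + d) do
      (_ , ℓq)  ← length-exists q
      (_ , ℓqu) ← length-exists (q ++ u)
      (p , c)   ← count-exists (reflections q) [ s ]
      (_ , c′)  ← count-exists (reflections u) s^q
      let c″ = subst (Count _ _) (count-reflections-even Q-s^q c′) c′
          cu = subst (Count _ _) (⊕-identityʳ p) (count-reflections-++ q u c c″)
      pure (LengthStep-+ p (length-∷ ℓq ℓsq c) (length-∷ ℓqu ℓsqu cu) (length-++-additive q Qq ℓq ℓqu))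
      where
      s^q = conjBy (reverse q) [ s ]
      Q-s^q : All Q s^q
      Q-s^q = All.++⁺ (All-reverse Qq) (Qs ∷ All-reverse (All-reverse Qq))

  minimal⇒NoInversionIn : ∀ {P Q u d} → Len u d → InSpecial M P u →
    (∀ t → All Q t → InSpecial M P t → ∀ m → Len (t ++ u) m → d ≤ m) → NoInversionIn Q u
  minimal⇒NoInversionIn {u = u} ℓu (u₁ , u₁≈u , Pu₁) minimal t Qt c =
    count-reflections-resp (~sym u₁≈u) c λ c₁ →
    length-exists (t ++ u) λ (m , ℓtu) →
    let (Pr , r≈t) = All.lookupAny (reflections-special Pu₁) (count-odd⇒Any c₁ refl)
    in <-irrefl refl (≤-<-trans (minimal t Qt (_ , r≈t , Pr) m ℓtu) (length-reflection-< ℓu c ℓtu))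

module SemidirectProduct (M : CoxeterMatrix) (A : FinAbActing M) where
  open CoxeterMatrix M
  open CoxeterGroup M
  open FinAbActing A
    using (Carrier; ε; _∙_; _⁻¹; identityˡ; inverseˡ; inverseʳ; act; act-≈; act-ε; act-∙; act-hom; ι; _·_; IsLength̃)
    renaming (_≈_ to _≈Ω_)

  map-act-ε : ∀ w → map (act ε) w ≡ w
  map-act-ε w = trans (map-cong act-ε w) (map-id w)

  act-cancel : ∀ {σ ρ} → σ ∙ ρ ≈Ω ε → ∀ s → act σ (act ρ s) ≡ s
  act-cancel {σ} {ρ} σρ≈ε s = trans (sym (act-∙ σ ρ s)) (trans (act-≈ σρ≈ε s) (act-ε s))

  map-act-cancel : ∀ {σ ρ} → σ ∙ ρ ≈Ω ε → ∀ w → map (act σ) (map (act ρ) w) ≡ w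
  map-act-cancel σρ≈ε w = trans (sym (map-∘ w)) (trans (map-cong (act-cancel σρ≈ε) w) (map-id w))

  IsLength-map-act : ∀ ρ {w n} → Len w n → Len (map (act ρ) w) n
  IsLength-map-act ρ {w} ((v , v≈w , lv) , v-min) =
    (map (act ρ) v , act-hom ρ v≈w , trans (length-map _ v) lv) ,
    λ y y≈ρw → subst (_ ≤_) (length-map _ y)
      (v-min (map (act (ρ ⁻¹)) y) (~trans (act-hom (ρ ⁻¹) y≈ρw) (≡⇒≈ (map-act-cancel (inverseˡ ρ) w))))

  InSpecial-map-act : ∀ {P : S → Set} ρ → (∀ s → P s → P (act ρ s)) → ∀ {w} → InSpecial M P w → InSpecial M P (map (act ρ) w)
  InSpecial-map-act ρ ρ-preserves-P (v , v≈w , Pv) =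
    map (act ρ) v , act-hom ρ v≈w , All.map⁺ (All.map (ρ-preserves-P _) Pv)

  IsLength-· : ∀ x u ρ y {n} → Len (x ++ u ++ map (act ρ) y) n → IsLength̃ ((ι x · (u , ρ)) · ι y) n
  IsLength-· x u ρ y {n} = subst (λ w → Len w n) (begin
    x ++ u ++ map (act ρ) y                      ≡⟨ ++-assoc x u _ ⟨
    (x ++ u) ++ map (act ρ) y                    ≡⟨ cong₂ (λ u′ y′ → (x ++ u′) ++ y′) (map-act-ε u) (map-cong (act-≈ (identityˡ ρ)) y) ⟨
    (x ++ map (act ε) u) ++ map (act (ε ∙ ρ)) y  ∎)
    where open ≡-Reasoning

  DoubleCosetMinimal : (S₁ S₂ : S → Set) → Word M → Carrier → Set
  DoubleCosetMinimal S₁ S₂ u ρ =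
    ∀ x y → InSpecial M S₁ x → InSpecial M S₂ x → InSpecial M S₁ y → InSpecial M S₂ y →
    ∀ a b → IsLength̃ (u , ρ) a → IsLength̃ ((ι x · (u , ρ)) · ι y) b → a ≤ b

  module _ {S₁ S₂ : S → Set} {u ρ d} (ℓσ : Len u d) (u∈W₁ : InSpecial M S₁ u)
           (σ-minimal : DoubleCosetMinimal S₁ S₂ u ρ) where

    length-w₂σ : ∀ {w₂ b c} → InSpecial M S₂ w₂ → Len w₂ c → Len (w₂ ++ u) b → b ≡ c + d
    length-w₂σ {w₂} (v₂ , v₂≈w₂ , S₂v₂) ℓw₂ ℓw₂u =
      length-++-additive ℓσ (minimal⇒NoInversionIn ℓσ u∈W₁ t-minimal) v₂ S₂v₂
        (IsLength-resp (~sym v₂≈w₂) ℓw₂) (IsLength-resp (++-congʳ u (~sym v₂≈w₂)) ℓw₂u)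
      where
      t-minimal : ∀ t → All S₂ t → InSpecial M S₁ t → ∀ m → Len (t ++ u) m → d ≤ m
      t-minimal t S₂t t∈W₁ m ℓtu = σ-minimal t [] t∈W₁ (t , ~refl , S₂t) InSpecial-[] InSpecial-[] d m ℓσ
        (IsLength-· t u ρ [] (subst (λ w → Len (t ++ w) m) (sym (++-identityʳ u)) ℓtu))

    -- ℓ(σ w₂) = ℓ(u ρ(w₂)) = ℓ(ρ(w₂)⁻¹ u⁻¹) is the case above for u⁻¹ and the generators
    -- ρ(S₂); minimality of σ applies because ℓ(t u⁻¹) = ℓ(σ y) for y = ρ⁻¹(t⁻¹).
    length-σw₂ : (∀ s → S₁ s → S₁ (act (ρ ⁻¹) s)) →
      ∀ {w₂ a c} → InSpecial M S₂ w₂ → Len w₂ c → Len (u ++ map (act ρ) w₂) a → a ≡ c + d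
    length-σw₂ ρ⁻¹-preserves-S₁ {w₂} (v₂ , v₂≈w₂ , S₂v₂) ℓw₂ ℓuρw₂ =
      length-++-additive (IsLength-reverse ℓσ)
        (minimal⇒NoInversionIn (IsLength-reverse ℓσ) (InSpecial-reverse u∈W₁) t-minimal)
        (reverse (map (act ρ) v₂)) (All-reverse (All.map⁺ (All.map S₂⇒ρS₂ S₂v₂)))
        (IsLength-reverse (IsLength-map-act ρ (IsLength-resp (~sym v₂≈w₂) ℓw₂)))
        (IsLength-resp (~trans (≡⇒≈ (reverse-++ u _)) (++-congʳ (reverse u) (reverse-cong (act-hom ρ (~sym v₂≈w₂)))))
          (IsLength-reverse ℓuρw₂))
      where
      ρS₂ : S → Set
      ρS₂ s = S₂ (act (ρ ⁻¹) s)

      S₂⇒ρS₂ : ∀ {s} → S₂ s → ρS₂ (act ρ s)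
      S₂⇒ρS₂ {s} = subst S₂ (sym (act-cancel (inverseˡ ρ) s))

      t-minimal : ∀ t → All ρS₂ t → InSpecial M S₁ t → ∀ m → Len (t ++ reverse u) m → d ≤ m
      t-minimal t ρS₂t t∈W₁ m ℓtu⁻ =
        σ-minimal [] y InSpecial-[] InSpecial-[] y∈W₁ (y , ~refl , All.map⁺ (All-reverse ρS₂t)) d m ℓσ
          (IsLength-· [] u ρ y (subst (λ w → Len w m) [tu⁻]⁻≡uρy (IsLength-reverse ℓtu⁻)))
        where
        y = map (act (ρ ⁻¹)) (reverse t)
        y∈W₁ : InSpecial M S₁ y
        y∈W₁ = InSpecial-map-act (ρ ⁻¹) ρ⁻¹-preserves-S₁ (InSpecial-reverse t∈W₁)
        [tu⁻]⁻≡uρy : reverse (t ++ reverse u) ≡ u ++ map (act ρ) y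
        [tu⁻]⁻≡uρy = trans (reverse-++ t (reverse u))
          (cong₂ _++_ (reverse-involutive u) (sym (map-act-cancel (inverseʳ ρ) (reverse t))))

mainTheorem1 : (M : CoxeterMatrix) → (A : FinAbActing M) →
    let open CoxeterMatrix M in let open FinAbActing A in
    (S₁ S₂ : S → Set) → (Ω₁ : Subgroup) →
    (∀ ρ → Subgroup.mem Ω₁ ρ → ∀ s → S₁ s ⇔ S₁ (act ρ s)) →
    (u : Word M) → InSpecial M S₁ u → (ρ : Carrier) → Subgroup.mem Ω₁ ρ →
    (∀ x y → InSpecial M S₁ x → InSpecial M S₂ x → InSpecial M S₁ y → InSpecial M S₂ y →
    ∀ a b → IsLength̃ (u , ρ) a → IsLength̃ ((ι x · (u , ρ)) · ι y) b → a ≤ b) →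
    ∀ w₂ → InSpecial M S₂ w₂ →
    ∀ a b c d → IsLength̃ ((u , ρ) · ι w₂) a → IsLength̃ (ι w₂ · (u , ρ)) b →
    IsLength M w₂ c → IsLength̃ (u , ρ) d →
    (a ≡ c + d) × (b ≡ c + d)
mainTheorem1 M A S₁ S₂ Ω₁ Ω₁-fixes-S₁ u u∈W₁ ρ ρ∈Ω₁ σ-minimal w₂ w₂∈W₂ a b c d ℓσw₂ ℓw₂σ ℓw₂ ℓσ =
    length-σw₂ ℓσ u∈W₁ σ-minimal ρ⁻¹-preserves-S₁ w₂∈W₂ ℓw₂ ℓσw₂
  , length-w₂σ ℓσ u∈W₁ σ-minimal w₂∈W₂ ℓw₂ (IsLength-resp (≡⇒≈ (cong (w₂ ++_) (map-act-ε u))) ℓw₂σ)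
  where
  open CoxeterGroup M using (IsLength-resp; ≡⇒≈)
  open SemidirectProduct M A
  open FinAbActing A using (act; _⁻¹; module Subgroup)

  ρ⁻¹-preserves-S₁ : ∀ s → S₁ s → S₁ (act (ρ ⁻¹) s)
  ρ⁻¹-preserves-S₁ s = Equivalence.to (Ω₁-fixes-S₁ (ρ ⁻¹) (Subgroup.has-⁻¹ Ω₁ ρ∈Ω₁) s)
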